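{- Let $c>1$ be an integer. There exists a positive constant $\mathcal C_1$, depending only on $c$ and effectively computable, such that for all integers $a,b>1$ with $a,b,c$ pairwise relatively prime and $\max\{a,b\}>\mathcal C_1$, every solution $(x,y,z)$ in positive integers of $a^x+b^y=c^z$ satisfies $\gcd(x,y,c)=1$. -}

{-# OPTIONS --safe #-}

-- If a prime p divides x, y and c, then A = a ^ (x / p) and B = b ^ (y / p) satisfy
-- A ^ p + B ^ p = c ^ z, so it suffices to bound A + B in terms of c alone.
-- For p = 2 the bases are odd, and A ^ 2 + B ^ 2 ≡ 2 (mod 4) forces z = 1.
-- For odd p, s = A + B and Φ = (A ^ p + B ^ p) / s satisfy s ^ (p - 1) / 2 ^ p ≤ Φ ≤ s ^ (p - 1),
-- and gcd s Φ divides p.  Moving at most one factor p between them gives a coprime factorisation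
-- X * Y = c ^ z with X ^ (p - 1) and Y within a factor (2p) ^ p of each other.  Such coprime
-- factors are z-th powers U ^ z, V ^ z of coprime divisors of c; unless U = 1, the bases
-- U ^ (p - 1) and V differ, and a Bernoulli estimate bounds z by (2p) ^ p c ^ (p - 1).

module Submission where

module OddPowerSum where

  open import Data.Nat.Base as ℕ using (zero; suc)
  open import Data.Integer.Base using (+_; -_; _+_; _*_; _^_)
  open import Data.Integer.Properties using (pos-+; pos-*)
  open import Data.Integer.Tactic.RingSolver using (solve-∀)
  open import Data.Product.Base using (∃; _,_)
  open import Relation.Binary.PropositionalEquality
  open ≡-Reasoning

  pos-^ : ∀ m n → + (m ℕ.^ n) ≡ (+ m) ^ n
  pos-^ m zero    = refl
  pos-^ m (suc n) = trans (pos-* m (m ℕ.^ n)) (cong (λ w → + m * w) (pos-^ m n))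

  neg-^-even : ∀ x m → (- x) ^ (m ℕ.* 2) ≡ x ^ (m ℕ.* 2)
  neg-^-even x zero    = refl
  neg-^-even x (suc m) = begin
    - x * (- x * (- x) ^ (m ℕ.* 2)) ≡⟨ cong (λ w → - x * (- x * w)) (neg-^-even x m) ⟩
    - x * (- x * x ^ (m ℕ.* 2))     ≡⟨ neg-square x (x ^ (m ℕ.* 2)) ⟩
    x * (x * x ^ (m ℕ.* 2))         ∎
    where
    neg-square : ∀ x w → - x * (- x * w) ≡ x * (x * w)
    neg-square = solve-∀

  binomial-mod-square : ∀ u v n →
    ∃ λ k → (u + v) ^ suc n ≡ u ^ suc n + + suc n * v * u ^ n + v * v * k
  binomial-mod-square u v zero    = + 0 , base u v
    where
    base : ∀ u v → (u + v) * + 1 ≡ u * + 1 + + 1 * v * + 1 + v * v * + 0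
    base = solve-∀
  binomial-mod-square u v (suc n) with binomial-mod-square u v n
  ... | k , eq = + suc n * u ^ n + (u + v) * k , (begin
    (u + v) * (u + v) ^ suc n                                   ≡⟨ cong ((u + v) *_) eq ⟩
    (u + v) * (u * u ^ n + + suc n * v * u ^ n + v * v * k)     ≡⟨ step u v k (u ^ n) (+ suc n) ⟩
    u * (u * u ^ n) + (+ 1 + + suc n) * v * (u * u ^ n)
      + v * v * (+ suc n * u ^ n + (u + v) * k)                 ∎)
    where
    step : ∀ u v k w n → (u + v) * (u * w + n * v * w + v * v * k)
                       ≡ u * (u * w) + (+ 1 + n) * v * (u * w) + v * v * (n * w + (u + v) * k)
    step = solve-∀

  -- Expanding B ^ p = (- A + (A + B)) ^ p to first order in A + B.
  odd-power-sum≡ : ∀ A B m → ∃ λ k →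
    + (A ℕ.^ suc (m ℕ.* 2) ℕ.+ B ℕ.^ suc (m ℕ.* 2))
      ≡ + (A ℕ.+ B) * (+ (suc (m ℕ.* 2) ℕ.* A ℕ.^ (m ℕ.* 2)) + + (A ℕ.+ B) * k)
  odd-power-sum≡ A B m with binomial-mod-square (- + A) (+ (A ℕ.+ B)) (m ℕ.* 2)
  ... | k , expansion = k , (begin
    + (A ℕ.^ p ℕ.+ B ℕ.^ p)
      ≡⟨ pos-+ (A ℕ.^ p) (B ℕ.^ p) ⟩
    + (A ℕ.^ p) + + (B ℕ.^ p)
      ≡⟨ cong₂ _+_ (pos-^ A p) (pos-^ B p) ⟩
    a ^ p + (+ B) ^ p
      ≡⟨ cong (λ b → a ^ p + b ^ p) B≡-A+s ⟩
    a ^ p + (- a + s) ^ p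
      ≡⟨ cong (λ w → a ^ p + w) expansion ⟩
    a * a ^ P + (- a * (- a) ^ P + + p * s * (- a) ^ P + s * s * k)
      ≡⟨ cong (λ w → a * a ^ P + (- a * w + + p * s * w + s * s * k)) (neg-^-even a m) ⟩
    a * a ^ P + (- a * a ^ P + + p * s * a ^ P + s * s * k)
      ≡⟨ cancel a s k (a ^ P) (+ p) ⟩
    s * (+ p * a ^ P + s * k)
      ≡⟨ cong (λ w → s * (w + s * k)) (sym pA^P≡) ⟩
    s * (+ (p ℕ.* A ℕ.^ P) + s * k)
      ∎)
    where
    P = m ℕ.* 2
    p = suc P
    a = + A
    s = + (A ℕ.+ B)
    B≡-A+s : + B ≡ - a + s
    B≡-A+s = trans (shift a (+ B)) (cong (λ b → - a + b) (sym (pos-+ A B)))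
      where
      shift : ∀ a b → b ≡ - a + (a + b)
      shift = solve-∀
    pA^P≡ : + (p ℕ.* A ℕ.^ P) ≡ + p * a ^ P
    pA^P≡ = trans (pos-* p (A ℕ.^ P)) (cong (λ w → + p * w) (pos-^ A P))
    cancel : ∀ a s k w n → a * w + (- a * w + n * s * w + s * s * k) ≡ s * (n * w + s * k)
    cancel = solve-∀

open import Data.Nat
open import Data.Nat.Properties
open import Data.Nat.Divisibility
open import Data.Nat.GCD
open import Data.Nat.Coprimality using (Coprime; coprime-divisor; gcd≡1⇒coprime; coprime⇒gcd≡1)
import Data.Nat.Coprimality as Coprimality
open import Data.Nat.Primality
open import Data.Nat.Primality.Factorisation using (factorise)
open import Data.Nat.Tactic.RingSolver using (solve-∀)
import Data.Integer.Base as ℤ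
import Data.Integer.Properties as ℤ
import Data.Integer.Divisibility.Signed as ℤ
open import Data.List.Base using ([]; _∷_)
open import Data.List.Relation.Unary.All using (_∷_)
open import Data.Nat.ListAction using (product)
open import Data.Product using (∃; ∃₂; _×_; _,_; uncurry)
open import Data.Sum using (_⊎_; inj₁; inj₂; [_,_]′)
open import Data.Empty using (⊥; ⊥-elim)
open import Function.Base using (_∘_)
open import Relation.Nullary using (¬_; Dec; yes; no; contradiction)
open import Relation.Binary.PropositionalEquality
open import Relation.Binary.Definitions using (tri<; tri≈; tri>)
open import Algebra.Properties.CommutativeSemigroup *-commutativeSemigroup using (x∙yz≈y∙xz)

open OddPowerSum using (odd-power-sum≡)

private
  variable
    c d k m n o z A B M X Y Φ : ℕ

^-distribʳ-* : ∀ m n k → (m * n) ^ k ≡ m ^ k * n ^ k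
^-distribʳ-* m n zero    = refl
^-distribʳ-* m n (suc k) =
  trans (cong (m * n *_) (^-distribʳ-* m n k)) (interchange m n (m ^ k) (n ^ k))
  where
  interchange : ∀ m n a b → m * n * (a * b) ≡ m * a * (n * b)
  interchange = solve-∀

^-comm-exponents : ∀ m a b → (m ^ a) ^ b ≡ (m ^ b) ^ a
^-comm-exponents m a b =
  trans (^-*-assoc m a b) (trans (cong (m ^_) (*-comm a b)) (sym (^-*-assoc m b a)))

^-monoˡ-∣ : ∀ k → m ∣ n → m ^ k ∣ n ^ k
^-monoˡ-∣ zero    m∣n = ∣-refl
^-monoˡ-∣ (suc k) m∣n = *-pres-∣ m∣n (^-monoˡ-∣ k m∣n)

m∣m^n : ∀ m n → .{{NonZero n}} → m ∣ m ^ n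
m∣m^n m (suc n) = m∣m*n (m ^ n)

m≤m^n : ∀ m n → .{{NonZero m}} → .{{NonZero n}} → m ≤ m ^ n
m≤m^n m (suc n) = m≤m*n m (m ^ n) {{m^n≢0 m n}}

coprime-*ˡ : Coprime m o → Coprime n o → Coprime (m * n) o
coprime-*ˡ {m} {o} m⊥o n⊥o {i} (i∣mn , i∣o) = n⊥o (coprime-divisor i⊥m i∣mn , i∣o)
  where
  i⊥m : Coprime i m
  i⊥m (j∣i , j∣m) = m⊥o (j∣m , ∣-trans j∣i i∣o)

coprime-^ˡ : ∀ k → Coprime m n → Coprime (m ^ k) n
coprime-^ˡ zero    m⊥n (i∣1 , _) = ∣1⇒≡1 i∣1
coprime-^ˡ (suc k) m⊥n           = coprime-*ˡ m⊥n (coprime-^ˡ k m⊥n)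

coprime-∣ : k ∣ m → d ∣ n → Coprime m n → Coprime k d
coprime-∣ k∣m d∣n m⊥n (i∣k , i∣d) = m⊥n (∣-trans i∣k k∣m , ∣-trans i∣d d∣n)

prime∤⇒coprime : ∀ {p} → Prime p → ¬ p ∣ n → Coprime p n
prime∤⇒coprime pr p∤n (i∣p , i∣n) with prime⇒irreducible pr i∣p
... | inj₁ i≡1 = i≡1
... | inj₂ refl = contradiction i∣n p∤n

≢1⇒prime-divisor : ∀ n → .{{NonZero n}} → n ≢ 1 → ∃ λ p → Prime p × p ∣ n
≢1⇒prime-divisor n n≢1 with factorise n
... | record { factors = [] ; isFactorisation = n≡1 } = contradiction n≡1 n≢1
... | record { factors = p ∷ ps ; isFactorisation = n≡p*ps ; factorsPrime = prime-p ∷ _ } =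
  p , prime-p , subst (p ∣_) (sym n≡p*ps) (m∣m*n (product ps))

no-common-prime⇒coprime : .{{NonZero n}} → (∀ {p} → Prime p → p ∣ m → p ∣ n → ⊥) → Coprime m n
no-common-prime⇒coprime {n} no-prime {i} (i∣m , i∣n) with i ≟ 1
... | yes i≡1 = i≡1
... | no i≢1 with ≢1⇒prime-divisor i {{≢-nonZero (λ { refl → ≢-nonZero⁻¹ n (0∣⇒≡0 i∣n) })}} i≢1
...   | p , prime-p , p∣i = ⊥-elim (no-prime prime-p (∣-trans p∣i i∣m) (∣-trans p∣i i∣n))

¬2∣⇒odd : ∀ n → ¬ 2 ∣ n → ∃ λ k → n ≡ suc (k * 2)
¬2∣⇒odd zero          2∤0   = contradiction (divides 0 refl) 2∤0
¬2∣⇒odd (suc zero)    _     = 0 , refl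
¬2∣⇒odd (suc (suc n)) 2∤2+n with ¬2∣⇒odd n (2∤2+n ∘ ∣m∣n⇒∣m+n ∣-refl)
... | k , refl = suc k , refl

coprime-to-even⇒odd : 2 ∣ c → Coprime A c → ∃ λ k → A ≡ suc (k * 2)
coprime-to-even⇒odd {c} {A} 2∣c A⊥c = ¬2∣⇒odd A λ 2∣A → contradiction (A⊥c (2∣A , 2∣c)) λ ()

prime⇒≡2∨odd : ∀ {p} → Prime p → p ≡ 2 ⊎ ∃ λ m → p ≡ suc (m * 2)
prime⇒≡2∨odd {p} prime-p with 2 ∣? p
... | yes 2∣p = inj₁ ([ (λ ()) , sym ]′ (prime⇒irreducible prime-p 2∣p))
... | no 2∤p  = inj₂ (¬2∣⇒odd p 2∤p)

∣*⇒∣gcd*gcd : ∀ m n → k ∣ m * n → k ∣ gcd m k * gcd n k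
∣*⇒∣gcd*gcd {k} m n k∣mn = begin
  k                               ∣⟨ gcd-greatest k∣[m,k]*n (n∣m*n (gcd m k)) ⟩
  gcd (gcd m k * n) (gcd m k * k) ≡⟨ sym (c*gcd[m,n]≡gcd[cm,cn] (gcd m k) n k) ⟩
  gcd m k * gcd n k               ∎
  where
  open ∣-Reasoning
  k∣[m,k]*n : k ∣ gcd m k * n
  k∣[m,k]*n = begin
    k                   ∣⟨ gcd-greatest (subst (k ∣_) (*-comm m n) k∣mn) (n∣m*n n) ⟩
    gcd (n * m) (n * k) ≡⟨ sym (c*gcd[m,n]≡gcd[cm,cn] n m k) ⟩
    n * gcd m k         ≡⟨ *-comm n (gcd m k) ⟩
    gcd m k * n         ∎

^∣gcd^*gcd^ : ∀ z → X * Y ≡ c ^ z → c ^ z ∣ gcd X c ^ z * gcd Y c ^ z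
^∣gcd^*gcd^ zero    _ = ∣-refl
^∣gcd^*gcd^ {X} {Y} {c} (suc z) XY≡c^z =
  subst (c ^ suc z ∣_) (^-distribʳ-* (gcd X c) (gcd Y c) (suc z))
    (^-monoˡ-∣ (suc z) (∣*⇒∣gcd*gcd X Y (subst (c ∣_) (sym XY≡c^z) (m∣m*n (c ^ z)))))

gcd^∣ : X * Y ≡ c ^ z → Coprime X Y → gcd X c ^ z ∣ X
gcd^∣ {X} {Y} {c} {z} XY≡c^z X⊥Y = coprime-divisor (coprime-^ˡ z U⊥Y) Uᶻ∣YX
  where
  U = gcd X c
  U⊥Y : Coprime U Y
  U⊥Y = coprime-∣ (gcd[m,n]∣m X c) ∣-refl X⊥Y
  Uᶻ∣YX : U ^ z ∣ Y * X
  Uᶻ∣YX = subst (U ^ z ∣_) (trans (sym XY≡c^z) (*-comm X Y)) (^-monoˡ-∣ z (gcd[m,n]∣n X c))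

divisors-of-equal-products : .{{NonZero (m * n)}} → m ∣ X → n ∣ Y → X * Y ≡ m * n → X ≡ m
divisors-of-equal-products {m} {n} (divides i refl) (divides j refl) XY≡mn =
  trans (cong (_* m) i≡1) (*-identityˡ m)
  where
  ij*mn≡1*mn : i * j * (m * n) ≡ 1 * (m * n)
  ij*mn≡1*mn = trans (interchange i j m n) (trans XY≡mn (sym (*-identityˡ (m * n))))
    where
    interchange : ∀ i j m n → i * j * (m * n) ≡ i * m * (j * n)
    interchange = solve-∀
  i≡1 : i ≡ 1
  i≡1 = m*n≡1⇒m≡1 i j (*-cancelʳ-≡ (i * j) 1 (m * n) ij*mn≡1*mn)

coprime-factor-of-power : .{{NonZero c}} → X * Y ≡ c ^ z → Coprime X Y → X ≡ gcd X c ^ z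
coprime-factor-of-power {c} {X} {Y} {z} XY≡cᶻ X⊥Y =
  divisors-of-equal-products {{UᶻVᶻ≢0}} Uᶻ∣X Vᶻ∣Y XY≡UᶻVᶻ
  where
  U = gcd X c
  V = gcd Y c
  Uᶻ∣X : U ^ z ∣ X
  Uᶻ∣X = gcd^∣ {c = c} {z} XY≡cᶻ X⊥Y
  Vᶻ∣Y : V ^ z ∣ Y
  Vᶻ∣Y = gcd^∣ {c = c} {z} (trans (*-comm Y X) XY≡cᶻ) (Coprimality.sym X⊥Y)
  XY≡UᶻVᶻ : X * Y ≡ U ^ z * V ^ z
  XY≡UᶻVᶻ = ∣-antisym (subst (_∣ U ^ z * V ^ z) (sym XY≡cᶻ) (^∣gcd^*gcd^ {X} {Y} z XY≡cᶻ))
                      (*-pres-∣ Uᶻ∣X Vᶻ∣Y)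
  UᶻVᶻ≢0 : NonZero (U ^ z * V ^ z)
  UᶻVᶻ≢0 = subst NonZero (trans (sym XY≡cᶻ) XY≡UᶻVᶻ) (m^n≢0 c z)

bernoulli : ∀ m n → m ^ n * (m + n) ≤ suc m ^ n * m
bernoulli m zero    = ≤-reflexive (cong (1 *_) (+-identityʳ m))
bernoulli m (suc n) = begin
  m ^ suc n * (m + suc n)              ≡⟨ expand m (m ^ n) n ⟩
  m * (m ^ n * (m + n)) + m * m ^ n    ≤⟨ +-mono-≤ (*-monoʳ-≤ m (bernoulli m n))
                                                    (*-monoʳ-≤ m (^-monoˡ-≤ n (n≤1+n m))) ⟩
  m * (suc m ^ n * m) + m * suc m ^ n  ≡⟨ collect m (suc m ^ n) ⟩
  suc m ^ suc n * m                    ∎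
  where
  open ≤-Reasoning
  expand : ∀ m w n → m * w * (m + suc n) ≡ m * (w * (m + n)) + m * w
  expand = solve-∀
  collect : ∀ m w → m * (w * m) + m * w ≡ suc m * w * m
  collect = solve-∀

exponent-bound : ∀ {j k} z → .{{NonZero j}} → j < k → k ^ z ≤ M * j ^ z → z ≤ M * j
exponent-bound {M} {j} {k} z j<k kᶻ≤Mjᶻ = m+n≤o⇒n≤o j (*-cancelˡ-≤ (j ^ z) {{m^n≢0 j z}} (begin
  j ^ z * (j + z)  ≤⟨ bernoulli j z ⟩
  suc j ^ z * j    ≤⟨ *-monoˡ-≤ j (^-monoˡ-≤ z j<k) ⟩
  k ^ z * j        ≤⟨ *-monoˡ-≤ j kᶻ≤Mjᶻ ⟩
  M * j ^ z * j    ≡⟨ rearrange M (j ^ z) j ⟩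
  j ^ z * (M * j)  ∎))
  where
  open ≤-Reasoning
  rearrange : ∀ M w j → M * w * j ≡ w * (M * j)
  rearrange = solve-∀

distinct-balanced-powers : ∀ {j k} z → .{{NonZero j}} → .{{NonZero k}} → j ≢ k →
  j ^ z ≤ M * k ^ z → k ^ z ≤ M * j ^ z → z ≤ M * (j ⊔ k)
distinct-balanced-powers {M} {j} {k} z j≢k jᶻ≤Mkᶻ kᶻ≤Mjᶻ with <-cmp j k
... | tri< j<k _ _ = ≤-trans (exponent-bound {M} z j<k kᶻ≤Mjᶻ) (*-monoʳ-≤ M (m≤m⊔n j k))
... | tri≈ _ j≡k _ = contradiction j≡k j≢k
... | tri> _ _ k<j = ≤-trans (exponent-bound {M} z k<j jᶻ≤Mkᶻ) (*-monoʳ-≤ M (m≤n⊔m j k))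

-- As X = U ^ z and Y = V ^ z, the hypotheses say that (U ^ P) ^ z and V ^ z agree up to a factor M.
coprime-balanced⇒bounded : ∀ P → .{{NonZero c}} → .{{NonZero P}} → X * Y ≡ c ^ z → Coprime X Y →
  X ^ P ≤ M * Y → Y ≤ M * X ^ P → X ≤ c ^ (M * c ^ P)
coprime-balanced⇒bounded {c} {X} {Y} {z} {M} P XY≡c^z X⊥Y Xᴾ≤MY Y≤MXᴾ =
  subst (_≤ c ^ (M * c ^ P)) (sym X≡Uᶻ) (Uᶻ-bound (U ^ P ≟ V))
  where
  U = gcd X c
  V = gcd Y c
  X≡Uᶻ : X ≡ U ^ z
  X≡Uᶻ = coprime-factor-of-power {c} {z = z} XY≡c^z X⊥Y
  Y≡Vᶻ : Y ≡ V ^ z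
  Y≡Vᶻ = coprime-factor-of-power {c} {z = z} (trans (*-comm Y X) XY≡c^z) (Coprimality.sym X⊥Y)
  U⊥V : Coprime U V
  U⊥V = coprime-∣ (gcd[m,n]∣m X c) (gcd[m,n]∣m Y c) X⊥Y
  U≤c : U ≤ c
  U≤c = ∣⇒≤ (gcd[m,n]∣n X c)
  V≤c : V ≤ c
  V≤c = ∣⇒≤ (gcd[m,n]∣n Y c)
  instance
    U≢0 : NonZero U
    U≢0 = ≢-nonZero (gcd[m,n]≢0 X c (inj₂ (≢-nonZero⁻¹ c)))
    V≢0 : NonZero V
    V≢0 = ≢-nonZero (gcd[m,n]≢0 Y c (inj₂ (≢-nonZero⁻¹ c)))
    Uᴾ≢0 : NonZero (U ^ P)
    Uᴾ≢0 = m^n≢0 U P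
  Xᴾ≡[Uᴾ]ᶻ : X ^ P ≡ (U ^ P) ^ z
  Xᴾ≡[Uᴾ]ᶻ = trans (cong (_^ P) X≡Uᶻ) (^-comm-exponents U z P)
  Uᶻ-bound : Dec (U ^ P ≡ V) → U ^ z ≤ c ^ (M * c ^ P)
  Uᶻ-bound (yes Uᴾ≡V) =
    subst (_≤ c ^ (M * c ^ P)) (sym (trans (cong (_^ z) U≡1) (^-zeroˡ z))) (m^n>0 c (M * c ^ P))
    where
    U≡1 : U ≡ 1
    U≡1 = U⊥V (∣-refl , subst (U ∣_) Uᴾ≡V (m∣m^n U P))
  Uᶻ-bound (no Uᴾ≢V) = ≤-trans (^-monoˡ-≤ z U≤c) (^-monoʳ-≤ c z≤Mcᴾ)
    where
    z≤Mcᴾ : z ≤ M * c ^ P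
    z≤Mcᴾ = ≤-trans
      (distinct-balanced-powers {M} z Uᴾ≢V (subst₂ (λ u v → u ≤ M * v) Xᴾ≡[Uᴾ]ᶻ Y≡Vᶻ Xᴾ≤MY)
                                      (subst₂ (λ v u → v ≤ M * u) Y≡Vᶻ Xᴾ≡[Uᴾ]ᶻ Y≤MXᴾ))
      (*-monoʳ-≤ M (⊔-lub (^-monoˡ-≤ P U≤c) (≤-trans V≤c (m≤m^n c P))))

sum-of-powers≤power-of-sum : ∀ A B n → A ^ suc n + B ^ suc n ≤ (A + B) ^ suc n
sum-of-powers≤power-of-sum A B zero    = ≤-reflexive (sym (*-distribʳ-+ 1 A B))
sum-of-powers≤power-of-sum A B (suc n) = begin
  A * A ^ suc n + B * B ^ suc n              ≤⟨ +-mono-≤ (*-monoʳ-≤ A Aⁿ≤) (*-monoʳ-≤ B Bⁿ≤) ⟩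
  A * (A + B) ^ suc n + B * (A + B) ^ suc n  ≡⟨ *-distribʳ-+ ((A + B) ^ suc n) A B ⟨
  (A + B) * (A + B) ^ suc n                  ∎
  where
  open ≤-Reasoning
  IH = sum-of-powers≤power-of-sum A B n
  Aⁿ≤ : A ^ suc n ≤ (A + B) ^ suc n
  Aⁿ≤ = ≤-trans (m≤m+n (A ^ suc n) (B ^ suc n)) IH
  Bⁿ≤ : B ^ suc n ≤ (A + B) ^ suc n
  Bⁿ≤ = ≤-trans (m≤n+m (B ^ suc n) (A ^ suc n)) IH

power-of-sum≤2^n*sum-of-powers : ∀ A B n → (A + B) ^ n ≤ 2 ^ n * (A ^ n + B ^ n)
power-of-sum≤2^n*sum-of-powers A B n = begin
  (A + B) ^ n            ≤⟨ ^-monoˡ-≤ n A+B≤2*[A⊔B] ⟩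
  (2 * (A ⊔ B)) ^ n      ≡⟨ ^-distribʳ-* 2 (A ⊔ B) n ⟩
  2 ^ n * (A ⊔ B) ^ n    ≤⟨ *-monoʳ-≤ (2 ^ n) [A⊔B]ⁿ≤ ⟩
  2 ^ n * (A ^ n + B ^ n) ∎
  where
  open ≤-Reasoning
  A+B≤2*[A⊔B] : A + B ≤ 2 * (A ⊔ B)
  A+B≤2*[A⊔B] = +-mono-≤ (m≤m⊔n A B) (subst (B ≤_) (sym (+-identityʳ (A ⊔ B))) (m≤n⊔m A B))
  [A⊔B]ⁿ≤ : (A ⊔ B) ^ n ≤ A ^ n + B ^ n
  [A⊔B]ⁿ≤ with ⊔-sel A B
  ... | inj₁ A⊔B≡A = subst (λ t → t ^ n ≤ A ^ n + B ^ n) (sym A⊔B≡A) (m≤m+n (A ^ n) (B ^ n))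
  ... | inj₂ A⊔B≡B = subst (λ t → t ^ n ≤ A ^ n + B ^ n) (sym A⊔B≡B) (m≤n+m (B ^ n) (A ^ n))

power-sum-cofactor-bounds : ∀ P → .{{NonZero (A + B)}} → (A + B) * Φ ≡ A ^ suc P + B ^ suc P →
  Φ ≤ (A + B) ^ P × (A + B) ^ P ≤ 2 ^ suc P * Φ
power-sum-cofactor-bounds {A} {B} {Φ} P sΦ≡ = *-cancelˡ-≤ s Φ-upper , *-cancelˡ-≤ s Φ-lower
  where
  open ≤-Reasoning
  s = A + B
  Φ-upper : s * Φ ≤ s * s ^ P
  Φ-upper = begin
    s * Φ                  ≡⟨ sΦ≡ ⟩
    A ^ suc P + B ^ suc P  ≤⟨ sum-of-powers≤power-of-sum A B P ⟩
    s ^ suc P              ∎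
  Φ-lower : s * s ^ P ≤ s * (2 ^ suc P * Φ)
  Φ-lower = begin
    s ^ suc P                          ≤⟨ power-of-sum≤2^n*sum-of-powers A B (suc P) ⟩
    2 ^ suc P * (A ^ suc P + B ^ suc P) ≡⟨ cong (2 ^ suc P *_) sΦ≡ ⟨
    2 ^ suc P * (s * Φ)                ≡⟨ x∙yz≈y∙xz (2 ^ suc P) s Φ ⟩
    s * (2 ^ suc P * Φ)                ∎

odd-power-sum-cofactor : ∀ m → Coprime A B → let p = suc (m * 2) in
  ∃ λ Φ → (A + B) * Φ ≡ A ^ p + B ^ p × (∀ {d} → d ∣ A + B → d ∣ Φ → d ∣ p)
odd-power-sum-cofactor {A} {B} m A⊥B with odd-power-sum≡ A B m
... | k , A^p+B^p≡s*t = ℤ.∣ t ∣ , s*Φ≡ , common∣p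
  where
  P = m * 2
  p = suc P
  s = A + B
  t = ℤ.+ (p * A ^ P) ℤ.+ ℤ.+ s ℤ.* k
  s*Φ≡ : s * ℤ.∣ t ∣ ≡ A ^ p + B ^ p
  s*Φ≡ = trans (sym (ℤ.abs-* (ℤ.+ s) t)) (cong ℤ.∣_∣ (sym A^p+B^p≡s*t))
  common∣p : ∀ {d} → d ∣ s → d ∣ ℤ.∣ t ∣ → d ∣ p
  common∣p {d} d∣s d∣Φ = coprime-divisor d⊥Aᴾ (subst (d ∣_) (*-comm p (A ^ P)) d∣pAᴾ)
    where
    d⊥Aᴾ : Coprime d (A ^ P)
    d⊥Aᴾ = Coprimality.sym (coprime-^ˡ P λ (i∣A , i∣d) →
             A⊥B (i∣A , ∣m+n∣m⇒∣n (∣-trans i∣d d∣s) i∣A))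
    d∣pAᴾ : d ∣ p * A ^ P
    d∣pAᴾ = ℤ.∣⇒∣ᵤ (ℤ.∣m+n∣n⇒∣m {m = ℤ.+ (p * A ^ P)} (ℤ.∣ᵤ⇒∣ {ℤ.+ d} {t} d∣Φ)
                                   (ℤ.∣m⇒∣m*n k (ℤ.∣ᵤ⇒∣ {ℤ.+ d} {ℤ.+ s} d∣s)))

-- gcd s Φ is 1 or p; in the second case one factor p is moved to the side where it is not repeated.
coprime-rescaling : ∀ {p s} → Prime p → (∀ {d} → d ∣ s → d ∣ Φ → d ∣ p) →
  ∃₂ λ X Y → X * Y ≡ s * Φ × Coprime X Y × s ≤ p * X × X ≤ p * s
coprime-rescaling {Φ} {p} {s} prime-p common∣p
  with prime⇒irreducible prime-p (common∣p (gcd[m,n]∣m s Φ) (gcd[m,n]∣n s Φ))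
... | inj₁ gcd≡1 = s , Φ , refl , gcd≡1⇒coprime gcd≡1 , s≤ps , s≤ps
  where s≤ps = m≤n*m s p {{prime⇒nonZero prime-p}}
... | inj₂ gcd≡p with subst (_∣ s) gcd≡p (gcd[m,n]∣m s Φ) | subst (_∣ Φ) gcd≡p (gcd[m,n]∣n s Φ)
... | divides s₁ refl | divides Φ₁ refl with p ∣? Φ₁
...   | no p∤Φ₁ =
  p * s , Φ₁ , move p s Φ₁ , coprime-*ˡ p⊥Φ₁ s⊥Φ₁ , ≤-trans (m≤n*m s p) (m≤n*m (p * s) p) , ≤-refl
  where
  instance _ = prime⇒nonZero prime-p
  move : ∀ p s f → p * s * f ≡ s * (f * p)
  move = solve-∀
  p⊥Φ₁ : Coprime p Φ₁
  p⊥Φ₁ = prime∤⇒coprime prime-p p∤Φ₁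
  s⊥Φ₁ : Coprime s Φ₁
  s⊥Φ₁ (d∣s , d∣Φ₁) = p⊥Φ₁ (common∣p d∣s (∣m⇒∣m*n p d∣Φ₁) , d∣Φ₁)
...   | yes p∣Φ₁ =
  s₁ , p * Φ , sym (*-assoc s₁ p Φ) , Coprimality.sym (coprime-*ˡ p⊥s₁ Φ⊥s₁) ,
  ≤-reflexive (*-comm s₁ p) , ≤-trans (m≤m*n s₁ p) (m≤n*m s p)
  where
  instance _ = prime⇒nonZero prime-p
  p∤s₁ : ¬ p ∣ s₁
  p∤s₁ p∣s₁ = <⇒≱ (m<m*n p p (nonTrivial⇒n>1 p {{prime⇒nonTrivial prime-p}}))
                  (∣⇒≤ (common∣p (*-monoˡ-∣ p p∣s₁) (*-monoˡ-∣ p p∣Φ₁)))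
  p⊥s₁ : Coprime p s₁
  p⊥s₁ = prime∤⇒coprime prime-p p∤s₁
  Φ⊥s₁ : Coprime Φ s₁
  Φ⊥s₁ (d∣Φ , d∣s₁) = p⊥s₁ (common∣p (∣m⇒∣m*n p d∣s₁) d∣Φ , d∣s₁)

rescaled-balance : ∀ P {s} → .{{NonZero s}} → Φ ≤ s ^ P → s ^ P ≤ 2 ^ suc P * Φ →
  X * Y ≡ s * Φ → s ≤ suc P * X → X ≤ suc P * s →
  X ^ P ≤ (2 * suc P) ^ suc P * Y × Y ≤ (2 * suc P) ^ suc P * X ^ P
rescaled-balance {Φ} {X} {Y} P {s} Φ≤sᴾ sᴾ≤2ᵖΦ XY≡sΦ s≤pX X≤ps = Xᴾ≤MY , Y≤MXᴾ
  where
  open ≤-Reasoning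
  p = suc P
  Φ≤pY : Φ ≤ p * Y
  Φ≤pY = *-cancelˡ-≤ s (begin
    s * Φ        ≡⟨ XY≡sΦ ⟨
    X * Y        ≤⟨ *-monoˡ-≤ Y X≤ps ⟩
    p * s * Y    ≡⟨ rearrange p s Y ⟩
    s * (p * Y)  ∎)
    where
    rearrange : ∀ p s y → p * s * y ≡ s * (p * y)
    rearrange = solve-∀
  Y≤pΦ : Y ≤ p * Φ
  Y≤pΦ = *-cancelˡ-≤ s (begin
    s * Y        ≤⟨ *-monoˡ-≤ Y s≤pX ⟩
    p * X * Y    ≡⟨ *-assoc p X Y ⟩
    p * (X * Y)  ≡⟨ cong (p *_) XY≡sΦ ⟩
    p * (s * Φ)  ≡⟨ x∙yz≈y∙xz p s Φ ⟩
    s * (p * Φ)  ∎)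
  Xᴾ≤MY : X ^ P ≤ (2 * p) ^ p * Y
  Xᴾ≤MY = begin
    X ^ P                     ≤⟨ ^-monoˡ-≤ P X≤ps ⟩
    (p * s) ^ P               ≡⟨ ^-distribʳ-* p s P ⟩
    p ^ P * s ^ P             ≤⟨ *-monoʳ-≤ (p ^ P) (≤-trans sᴾ≤2ᵖΦ (*-monoʳ-≤ (2 ^ p) Φ≤pY)) ⟩
    p ^ P * (2 ^ p * (p * Y)) ≡⟨ rearrange (p ^ P) (2 ^ p) p Y ⟩
    2 ^ p * p ^ p * Y         ≡⟨ cong (_* Y) (^-distribʳ-* 2 p p) ⟨
    (2 * p) ^ p * Y           ∎
    where
    rearrange : ∀ a b p y → a * (b * (p * y)) ≡ b * (p * a) * y
    rearrange = solve-∀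
  Y≤MXᴾ : Y ≤ (2 * p) ^ p * X ^ P
  Y≤MXᴾ = begin
    Y                    ≤⟨ Y≤pΦ ⟩
    p * Φ                ≤⟨ *-monoʳ-≤ p (≤-trans Φ≤sᴾ (^-monoˡ-≤ P s≤pX)) ⟩
    p * (p * X) ^ P      ≡⟨ cong (p *_) (^-distribʳ-* p X P) ⟩
    p * (p ^ P * X ^ P)  ≡⟨ *-assoc p (p ^ P) (X ^ P) ⟨
    p ^ p * X ^ P        ≤⟨ *-monoˡ-≤ (X ^ P) (^-monoˡ-≤ p (m≤n*m p 2)) ⟩
    (2 * p) ^ p * X ^ P  ∎

-- For odd p, A + B ≤ p * X with p ≤ c and X ≤ c ^ ((2p) ^ p * c ^ (p - 1)).
𝒞₁ : ℕ → ℕ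
𝒞₁ c = c ^ suc ((2 * c) ^ c * c ^ c)

c≤𝒞₁ : ∀ c → .{{NonZero c}} → c ≤ 𝒞₁ c
c≤𝒞₁ c = m≤m^n c (suc ((2 * c) ^ c * c ^ c))

odd-prime-exponent-bounded : ∀ m → .{{NonZero c}} → .{{NonZero A}} →
  Prime (suc (m * 2)) → suc (m * 2) ≤ c → Coprime A B →
  A ^ suc (m * 2) + B ^ suc (m * 2) ≡ c ^ z → A + B ≤ 𝒞₁ c
odd-prime-exponent-bounded {c} {A} {B} {z} m prime-p p≤c A⊥B A^p+B^p≡c^z
  with odd-power-sum-cofactor {A} {B} m A⊥B
... | Φ , sΦ≡A^p+B^p , common∣p with coprime-rescaling prime-p common∣p
... | X , Y , XY≡sΦ , X⊥Y , s≤pX , X≤ps = begin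
  A + B  ≤⟨ s≤pX ⟩
  p * X  ≤⟨ *-mono-≤ p≤c (≤-trans X≤ (^-monoʳ-≤ c exponent≤)) ⟩
  𝒞₁ c   ∎
  where
  open ≤-Reasoning
  P = m * 2
  p = suc P
  instance
    P≢0 : NonZero P
    P≢0 = m*n≢0 m 2 {{≢-nonZero λ { refl → ¬prime[1] prime-p }}}
    s≢0 : NonZero (A + B)
    s≢0 = >-nonZero (≤-trans (>-nonZero⁻¹ A) (m≤m+n A B))
  balance : X ^ P ≤ (2 * p) ^ p * Y × Y ≤ (2 * p) ^ p * X ^ P
  balance = uncurry (rescaled-balance {Φ} P {A + B})
                    (power-sum-cofactor-bounds {A} {B} P sΦ≡A^p+B^p) XY≡sΦ s≤pX X≤ps
  X≤ : X ≤ c ^ ((2 * p) ^ p * c ^ P)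
  X≤ = uncurry (coprime-balanced⇒bounded {c} {z = z} {M = (2 * p) ^ p} P XY≡cᶻ X⊥Y) balance
    where XY≡cᶻ = trans XY≡sΦ (trans sΦ≡A^p+B^p A^p+B^p≡c^z)
  exponent≤ : (2 * p) ^ p * c ^ P ≤ (2 * c) ^ c * c ^ c
  exponent≤ = *-mono-≤ (≤-trans (^-monoˡ-≤ p (*-monoʳ-≤ 2 p≤c))
                                (^-monoʳ-≤ (2 * c) {{m*n≢0 2 c}} p≤c))
                       (^-monoʳ-≤ c (≤-trans (n≤1+n P) p≤c))

even-base-squares-bounded : 2 ∣ c → Coprime A c → Coprime B c → A ^ 2 + B ^ 2 ≡ c ^ z → A + B ≤ c
even-base-squares-bounded {c} {A} {B} {z} 2∣c A⊥c B⊥c A²+B²≡cᶻ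
  with coprime-to-even⇒odd 2∣c A⊥c | coprime-to-even⇒odd 2∣c B⊥c
... | a , refl | b , refl = bounded z (trans (sym (odd-squares a b)) A²+B²≡cᶻ)
  where
  Q = a * a + a + b * b + b
  odd-squares : ∀ u v → (1 + u * 2) * ((1 + u * 2) * 1) + (1 + v * 2) * ((1 + v * 2) * 1)
                      ≡ 2 + 4 * (u * u + u + v * v + v)
  odd-squares = solve-∀
  bounded : ∀ z → 2 + 4 * Q ≡ c ^ z → suc (a * 2) + suc (b * 2) ≤ c
  bounded zero ()
  bounded (suc zero) 2+4Q≡c = begin
    suc (a * 2) + suc (b * 2)          ≤⟨ +-mono-≤ (m≤m*n (suc (a * 2)) _) (m≤m*n (suc (b * 2)) _) ⟩
    suc (a * 2) ^ 2 + suc (b * 2) ^ 2  ≡⟨ odd-squares a b ⟩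
    2 + 4 * Q                          ≡⟨ 2+4Q≡c ⟩
    c * 1                              ≡⟨ *-identityʳ c ⟩
    c                                  ∎
    where open ≤-Reasoning
  bounded (suc (suc z)) 2+4Q≡cᶻ = contradiction (∣⇒≤ 4∣2) λ { (s≤s (s≤s ())) }
    where
    4∣cᶻ : 4 ∣ c ^ suc (suc z)
    4∣cᶻ = ∣-trans (*-pres-∣ 2∣c 2∣c) (*-monoʳ-∣ c (m∣m*n (c ^ z)))
    4∣2 : 4 ∣ 2
    4∣2 = ∣m+n∣m⇒∣n (subst (4 ∣_) (trans (sym 2+4Q≡cᶻ) (+-comm 2 (4 * Q))) 4∣cᶻ) (m∣m*n Q)

prime-exponent-bounded : ∀ {p} → .{{NonZero c}} → .{{NonZero A}} → Prime p → p ∣ c →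
  Coprime A B → Coprime A c → Coprime B c → A ^ p + B ^ p ≡ c ^ z → A + B ≤ 𝒞₁ c
prime-exponent-bounded {c} {z = z} prime-p p∣c A⊥B A⊥c B⊥c A^p+B^p≡cᶻ with prime⇒≡2∨odd prime-p
... | inj₁ refl       = ≤-trans (even-base-squares-bounded {z = z} p∣c A⊥c B⊥c A^p+B^p≡cᶻ) (c≤𝒞₁ c)
... | inj₂ (m , refl) = odd-prime-exponent-bounded {z = z} m prime-p (∣⇒≤ p∣c) A⊥B A^p+B^p≡cᶻ

common-prime-exponent⇒bounded : ∀ {a b x y p} → .{{NonZero c}} → 1 < a → 1 < b →
  Coprime a b → Coprime a c → Coprime b c → 0 < x → 0 < y → a ^ x + b ^ y ≡ c ^ z →
  Prime p → p ∣ x → p ∣ y → p ∣ c → a ⊔ b ≤ 𝒞₁ c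
common-prime-exponent⇒bounded {c} {z} {a} {b} {p = p} 1<a 1<b a⊥b a⊥c b⊥c 0<x 0<y aˣ+bʸ≡cᶻ
  prime-p (divides x′ refl) (divides y′ refl) p∣c = begin
  a ⊔ b    ≤⟨ ⊔-mono-≤ (m≤m^n a x′) (m≤m^n b y′) ⟩
  A₀ ⊔ B₀  ≤⟨ m⊔n≤m+n A₀ B₀ ⟩
  A₀ + B₀  ≤⟨ prime-exponent-bounded {z = z} prime-p p∣c A₀⊥B₀
                (coprime-^ˡ x′ a⊥c) (coprime-^ˡ y′ b⊥c) A₀ᵖ+B₀ᵖ≡cᶻ ⟩
  𝒞₁ c     ∎
  where
  open ≤-Reasoning
  A₀ = a ^ x′
  B₀ = b ^ y′
  instance
    a≢0 : NonZero a
    a≢0 = >-nonZero (<⇒≤ 1<a)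
    b≢0 : NonZero b
    b≢0 = >-nonZero (<⇒≤ 1<b)
    x′≢0 : NonZero x′
    x′≢0 = m*n≢0⇒m≢0 x′ {{>-nonZero 0<x}}
    y′≢0 : NonZero y′
    y′≢0 = m*n≢0⇒m≢0 y′ {{>-nonZero 0<y}}
    A₀≢0 : NonZero A₀
    A₀≢0 = m^n≢0 a x′
  A₀⊥B₀ : Coprime A₀ B₀
  A₀⊥B₀ = coprime-^ˡ x′ (Coprimality.sym (coprime-^ˡ y′ (Coprimality.sym a⊥b)))
  A₀ᵖ+B₀ᵖ≡cᶻ : A₀ ^ p + B₀ ^ p ≡ c ^ z
  A₀ᵖ+B₀ᵖ≡cᶻ = trans (cong₂ _+_ (^-*-assoc a x′ p) (^-*-assoc b y′ p)) aˣ+bʸ≡cᶻ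

lemma4p1 : (c : ℕ) → 1 < c →
    ∃ λ (C₁ : ℕ) → 0 < C₁ ×
      ((a b : ℕ) → 1 < a → 1 < b →
        gcd a b ≡ 1 → gcd a c ≡ 1 → gcd b c ≡ 1 →
        C₁ < a ⊔ b →
        (x y z : ℕ) → 0 < x → 0 < y → 0 < z →
        a ^ x + b ^ y ≡ c ^ z →
        gcd (gcd x y) c ≡ 1)
lemma4p1 c 1<c = 𝒞₁ c , ≤-trans (<⇒≤ 1<c) (c≤𝒞₁ c) ,
  λ a b 1<a 1<b gcd[a,b]≡1 gcd[a,c]≡1 gcd[b,c]≡1 𝒞₁<a⊔b x y z 0<x 0<y _ aˣ+bʸ≡cᶻ →
    coprime⇒gcd≡1 (no-common-prime⇒coprime λ prime-p p∣gcd[x,y] p∣c →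
      <⇒≱ 𝒞₁<a⊔b (common-prime-exponent⇒bounded {z = z} 1<a 1<b
        (gcd≡1⇒coprime gcd[a,b]≡1) (gcd≡1⇒coprime gcd[a,c]≡1) (gcd≡1⇒coprime gcd[b,c]≡1)
        0<x 0<y aˣ+bʸ≡cᶻ prime-p
        (∣-trans p∣gcd[x,y] (gcd[m,n]∣m x y)) (∣-trans p∣gcd[x,y] (gcd[m,n]∣n x y)) p∣c))
  where
  instance
    c≢0 : NonZero c
    c≢0 = >-nonZero (<⇒≤ 1<c)
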